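{- Let $\Gamma$ be a digraph, $F$ a maximum out forest of $\Gamma$, and $i,j$ vertices. If there is a path from $i$ to $j$ in $\Gamma$ and there is no path from $i$ to $j$ in $F$, then $F$ contains an arc $(k,j)$ for some $k\neq i$, or $i$ is reachable from $j$ in $F$.
   Context: $\Gamma$ is a finite loopless digraph. $w$ is reachable from $z$ if $w=z$ or there is a directed path from $z$ to $w$. A diverging forest is a digraph without circuits in which every vertex has indegree at most 1. A maximum out forest is a spanning subgraph of $\Gamma$ which is a diverging forest with the maximum possible number of arcs. -}

module Defs where

open import Data.Nat using (ℕ; _≤_)
open import Data.Fin using (Fin)
open import Data.Bool using (Bool; true; false)
open import Data.List using (List; sum; map; allFin; length; filter; cartesianProduct)
open import Data.Product using (_×_; _,_; proj₁; proj₂)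
open import Relation.Binary.PropositionalEquality using (_≡_)
open import Relation.Nullary using (¬_)
open import Data.Bool.Properties using () renaming (T? to T?)
open import Data.Bool using (T)

record Digraph (n : ℕ) : Set where
  field
    arc      : Fin n → Fin n → Bool
    loopless : ∀ i → arc i i ≡ false
open Digraph public

data Path {n : ℕ} (A : Fin n → Fin n → Bool) : Fin n → Fin n → Set where
  edge : ∀ {i j} → A i j ≡ true → Path A i j
  step : ∀ {i j k} → A i j ≡ true → Path A j k → Path A i k

data Reachable {n : ℕ} (A : Fin n → Fin n → Bool) (z : Fin n) : Fin n → Set where
  here : Reachable A z z
  path : ∀ {w} → Path A z w → Reachable A z w

arcCount : {n : ℕ} → (Fin n → Fin n → Bool) → ℕ
arcCount {n} A = length (filter (λ p → T? (A (proj₁ p) (proj₂ p)))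
                                (cartesianProduct (allFin n) (allFin n)))

SpanningSubgraph : {n : ℕ} → Digraph n → (Fin n → Fin n → Bool) → Set
SpanningSubgraph Γ F = ∀ i j → F i j ≡ true → arc Γ i j ≡ true

IsDivergingForest : {n : ℕ} → (Fin n → Fin n → Bool) → Set
IsDivergingForest F =
  (∀ v → ¬ Path F v v) ×
  (∀ k k' j → F k j ≡ true → F k' j ≡ true → k ≡ k')

IsOutForest : {n : ℕ} → Digraph n → (Fin n → Fin n → Bool) → Set
IsOutForest Γ F = SpanningSubgraph Γ F × IsDivergingForest F

IsMaximumOutForest : {n : ℕ} → Digraph n → (Fin n → Fin n → Bool) → Set
IsMaximumOutForest Γ F =
  IsOutForest Γ F × (∀ G → IsOutForest Γ G → arcCount G ≤ arcCount F)

{-# OPTIONS --safe #-}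

-- If j has an F-parent k, then k ≠ i because F has no path from i to j. Otherwise j is a root
-- of F, and we show that j reaches in F every vertex x from which Γ has a path x → y ⇝ j, by
-- induction on that path, simultaneously for all maximum out forests with root j. Suppose j does
-- not reach x. Making x the only parent of y creates no circuit, since y does not reach x either.
-- If y = j this adds an arc, contradicting maximality. Otherwise it trades the parent of y for x,
-- which gives another maximum out forest with root j; by induction j reaches y there, hence
-- reaches x, and a path from j to x in the new forest is already a path in F.

module Submission where

open import Defs
open import Level using (Level; 0ℓ)
open import Data.Nat using (ℕ; zero; suc; _≤_; _<_; z≤n; s≤s)
open import Data.Nat.Properties
  using (≤-trans; ≤-reflexive; m≤n⇒m≤1+n; <⇒≱; 1+n≰n; module ≤-Reasoning)
open import Data.Fin using (Fin; _≟_)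
open import Data.Fin.Properties using (any?)
open import Data.Bool using (Bool; true; T; if_then_else_)
import Data.Bool as Bool
open import Data.Bool.Properties using (T?; T-≡)
open import Data.List using ([]; _∷_; length; filter; allFin; cartesianProduct)
open import Data.List.Properties using (length-filter; length-tabulate)
open import Data.List.Membership.Propositional using (_∈_)
open import Data.List.Membership.Propositional.Properties using (∈-allFin; ∈-cartesianProduct⁺)
open import Data.List.Relation.Unary.Any using (here; there)
open import Data.List.Relation.Unary.All as All using (All; []; _∷_)
open import Data.List.Relation.Unary.AllPairs using (_∷_)
open import Data.List.Relation.Unary.Unique.Propositional using (Unique)
open import Data.List.Relation.Unary.Unique.Propositional.Properties
  using (allFin⁺; cartesianProduct⁺)
open import Data.Product using (∃; _×_; _,_; proj₁; proj₂)
open import Data.Product.Properties using (≡-dec)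
open import Data.Sum using (_⊎_; inj₁; inj₂)
import Data.Sum as Sum
open import Function using (_∘_; case_of_; Equivalence)
open import Relation.Binary.Definitions using (DecidableEquality)
open import Relation.Binary.PropositionalEquality
  using (_≡_; _≢_; refl; sym; trans; cong; subst)
open import Relation.Nullary using (¬_; Dec; yes; no; does; contradiction; ¬?)
open import Relation.Nullary.Decidable
  using (dec-true; dec-false; decidable-stable; map′; _×-dec_; _⊎-dec_)
open import Relation.Unary using (Pred; Decidable; _⊆_)

private
  variable
    a p q ℓ : Level
    X : Set a
    n : ℕ

module _ {P : Pred X p} {Q : Pred X q} (P? : Decidable P) (Q? : Decidable Q) where

  filter-length-mono : ∀ {xs} → All (λ x → P x → Q x) xs →
                       length (filter P? xs) ≤ length (filter Q? xs)
  filter-length-mono {xs = []}     []               = z≤n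
  filter-length-mono {xs = x ∷ xs} (P⇒Q ∷ P⇒Q-rest) with P? x | Q? x
  ... | yes _  | yes _  = s≤s (filter-length-mono P⇒Q-rest)
  ... | yes Px | no ¬Qx = contradiction (P⇒Q Px) ¬Qx
  ... | no _   | yes _  = m≤n⇒m≤1+n (filter-length-mono P⇒Q-rest)
  ... | no _   | no _   = filter-length-mono P⇒Q-rest

  filter-length-< : ∀ {xs e} → All (λ x → P x → Q x) xs → e ∈ xs → ¬ P e → Q e →
                    length (filter P? xs) < length (filter Q? xs)
  filter-length-< {xs = x ∷ xs} (_ ∷ P⇒Q-rest) (here refl) ¬Px Qx with P? x | Q? x
  ... | yes Px | _      = contradiction Px ¬Px
  ... | no _   | no ¬Qx = contradiction Qx ¬Qx
  ... | no _   | yes _  = s≤s (filter-length-mono P⇒Q-rest)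
  filter-length-< {xs = x ∷ xs} (P⇒Q ∷ P⇒Q-rest) (there e∈xs) ¬Pe Qe with P? x | Q? x
  ... | yes _  | yes _  = s≤s (filter-length-< P⇒Q-rest e∈xs ¬Pe Qe)
  ... | yes Px | no ¬Qx = contradiction (P⇒Q Px) ¬Qx
  ... | no _   | yes _  = m≤n⇒m≤1+n (filter-length-< P⇒Q-rest e∈xs ¬Pe Qe)
  ... | no _   | no _   = filter-length-< P⇒Q-rest e∈xs ¬Pe Qe

  filter-length-≤-suc : ∀ {xs e} → Unique xs → (∀ {x} → x ≢ e → P x → Q x) →
                        length (filter P? xs) ≤ suc (length (filter Q? xs))
  filter-length-≤-suc {xs = []}     _              _   = z≤n
  filter-length-≤-suc {xs = x ∷ xs} (x∉xs ∷ unique) P⇒Q with P? x | Q? x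
  ... | yes _  | yes _  = s≤s (filter-length-≤-suc unique P⇒Q)
  ... | no _   | yes _  = m≤n⇒m≤1+n (filter-length-≤-suc unique P⇒Q)
  ... | no _   | no _   = filter-length-≤-suc unique P⇒Q
  ... | yes Px | no ¬Qx = s≤s (filter-length-mono (All.map P⇒Q-away-from-x x∉xs))
    where
    P⇒Q-away-from-x : ∀ {y} → x ≢ y → P y → Q y
    P⇒Q-away-from-x x≢y = P⇒Q λ { refl → ¬Qx (P⇒Q x≢y Px) }

filter-length-exchange : DecidableEquality X → {P : Pred X p} {Q : Pred X q}
                         (P? : Decidable P) (Q? : Decidable Q) →
                         ∀ {xs e e′} → Unique xs → e′ ∈ xs → ¬ P e′ → Q e′ →
                         (∀ {x} → x ≢ e → P x → Q x) →
                         length (filter P? xs) ≤ length (filter Q? xs)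
filter-length-exchange _≟ₐ_ {P = P} {Q = Q} P? Q? {xs} {e} {e′} unique e′∈xs ¬Pe′ Qe′ P⇒Q =
  begin
    length (filter P? xs)         ≤⟨ filter-length-≤-suc P? Q′? unique P⇒Q′ ⟩
    suc (length (filter Q′? xs))  ≤⟨ filter-length-< Q′? Q? (All.tabulate λ _ → proj₁)
                                                      e′∈xs (λ Q′e′ → proj₂ Q′e′ refl) Qe′ ⟩
    length (filter Q? xs)         ∎
  where
  open ≤-Reasoning
  Q′? : Decidable (λ x → Q x × x ≢ e′)
  Q′? x = Q? x ×-dec ¬? (x ≟ₐ e′)
  P⇒Q′ : ∀ {x} → x ≢ e → P x → Q x × x ≢ e′
  P⇒Q′ x≢e Px = P⇒Q x≢e Px , λ { refl → ¬Pe′ Px }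

Adjacency : ℕ → Set
Adjacency n = Fin n → Fin n → Bool

module _ {A : Adjacency n} where

  path-++ : ∀ {u v w} → Path A u v → Path A v w → Path A u w
  path-++ (edge uv)    q = step uv q
  path-++ (step uv p)  q = step uv (path-++ p q)

  reachable-trans : ∀ {u v w} → Reachable A u v → Reachable A v w → Reachable A u w
  reachable-trans here     r        = r
  reachable-trans (path p) here     = path p
  reachable-trans (path p) (path q) = path (path-++ p q)

  arc-reachable : ∀ {u v w} → A u v ≡ true → Reachable A v w → Path A u w
  arc-reachable uv here     = edge uv
  arc-reachable uv (path p) = step uv p

  reachable-arc : ∀ {u v w} → Reachable A u v → A v w ≡ true → Path A u w
  reachable-arc here     vw = edge vw
  reachable-arc (path p) vw = path-++ p (edge vw)

  path-last : ∀ {u w} → Path A u w → ∃ λ v → Reachable A u v × A v w ≡ true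
  path-last (edge uw)   = _ , here , uw
  path-last (step uv p) with path-last p
  ... | v , r , vw = v , path (arc-reachable uv r) , vw

  path-closed : (C : Pred (Fin n) ℓ) → (∀ {v w} → C v → A v w ≡ true → C w) →
                ∀ {u w} → C u → Path A u w → C w
  path-closed C closed Cu (edge uw)   = closed Cu uw
  path-closed C closed Cu (step uv p) = path-closed C closed (closed Cu uv) p

  reachable-closed : (C : Pred (Fin n) ℓ) → (∀ {v w} → C v → A v w ≡ true → C w) →
                     ∀ {u w} → C u → Reachable A u w → C w
  reachable-closed C closed Cu here     = Cu
  reachable-closed C closed Cu (path p) = path-closed C closed Cu p

module _ {S : ℕ → Pred (Fin n) ℓ} (S? : ∀ k → Decidable (S k))
         (S-mono : ∀ k → S k ⊆ S (suc k)) where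

  private
    size : ℕ → ℕ
    size k = length (filter (S? k) (allFin n))

  chain-grows-or-stabilises : ∀ k → (∃ λ j → S (suc j) ⊆ S j) ⊎ k ≤ size k
  chain-grows-or-stabilises zero = inj₂ z≤n
  chain-grows-or-stabilises (suc k) with chain-grows-or-stabilises k
  ... | inj₁ stable = inj₁ stable
  ... | inj₂ k≤size with any? (λ w → S? (suc k) w ×-dec ¬? (S? k w))
  ...   | yes (w , new , ¬old) = inj₂ (≤-trans (s≤s k≤size) grows)
    where
    grows : size k < size (suc k)
    grows = filter-length-< (S? k) (S? (suc k)) (All.tabulate λ _ → S-mono k) (∈-allFin w) ¬old new
  ...   | no ¬new =
    inj₁ (k , λ {w} new → decidable-stable (S? k w) λ ¬old → ¬new (w , new , ¬old))

  chain-stabilises : ∃ λ j → S (suc j) ⊆ S j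
  chain-stabilises with chain-grows-or-stabilises (suc n)
  ... | inj₁ stable = stable
  ... | inj₂ n<size = contradiction (≤-trans n<size size≤n) 1+n≰n
    where
    size≤n : size (suc n) ≤ n
    size≤n = ≤-trans (length-filter (S? (suc n)) (allFin n))
                     (≤-reflexive (length-tabulate (λ i → i)))

module _ (A : Adjacency n) (z : Fin n) where

  ReachableWithin : ℕ → Pred (Fin n) 0ℓ
  ReachableWithin zero    w = z ≡ w
  ReachableWithin (suc k) w = ReachableWithin k w ⊎ ∃ λ v → ReachableWithin k v × A v w ≡ true

  reachableWithin? : ∀ k → Decidable (ReachableWithin k)
  reachableWithin? zero    w = z ≟ w
  reachableWithin? (suc k) w =
    reachableWithin? k w ⊎-dec any? (λ v → reachableWithin? k v ×-dec (A v w Bool.≟ true))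

  reachableWithin-start : ∀ k → ReachableWithin k z
  reachableWithin-start zero    = refl
  reachableWithin-start (suc k) = inj₁ (reachableWithin-start k)

  reachableWithin⇒reachable : ∀ k {w} → ReachableWithin k w → Reachable A z w
  reachableWithin⇒reachable zero    refl                = here
  reachableWithin⇒reachable (suc k) (inj₁ r)            = reachableWithin⇒reachable k r
  reachableWithin⇒reachable (suc k) (inj₂ (_ , r , vw)) =
    path (reachable-arc (reachableWithin⇒reachable k r) vw)

reachable? : (A : Adjacency n) → ∀ z w → Dec (Reachable A z w)
reachable? A z w with chain-stabilises (reachableWithin? A z) (λ _ → inj₁)
... | j , stable =
  map′ (reachableWithin⇒reachable A z j) reachable⇒within (reachableWithin? A z j w)
  where
  reachable⇒within : Reachable A z w → ReachableWithin A z j w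
  reachable⇒within = reachable-closed (ReachableWithin A z j)
                       (λ r vw → stable (inj₂ (_ , r , vw))) (reachableWithin-start A z j)

module _ {A B : Adjacency n} {x y : Fin n}
         (B⊆A+xy : ∀ {c d} → B c d ≡ true → (c ≡ x × d ≡ y) ⊎ A c d ≡ true) where

  path-decompose : ∀ {u w} → Path B u w → Path A u w ⊎ (Reachable A u x × Reachable B y w)
  path-decompose (edge uw) with B⊆A+xy uw
  ... | inj₁ (refl , refl) = inj₂ (here , here)
  ... | inj₂ uw′           = inj₁ (edge uw′)
  path-decompose (step uv p) with B⊆A+xy uv
  ... | inj₁ (refl , refl) = inj₂ (here , path p)
  ... | inj₂ uv′ with path-decompose p
  ...   | inj₁ q        = inj₁ (step uv′ q)
  ...   | inj₂ (vx , yw) = inj₂ (path (arc-reachable uv′ vx) , yw)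

  reachable-decompose : ∀ {u w} → Reachable B u w → Reachable A u w ⊎ Reachable A u x
  reachable-decompose here     = inj₁ here
  reachable-decompose (path p) = Sum.map path proj₁ (path-decompose p)

  acyclic-extend : (∀ v → ¬ Path A v v) → ¬ Reachable A y x → ∀ v → ¬ Path B v v
  acyclic-extend acyclic ¬yx v cycle with path-decompose cycle
  ... | inj₁ cycle′ = acyclic v cycle′
  ... | inj₂ (vx , yv) with reachable-decompose yv
  ...   | inj₁ yv′ = ¬yx (reachable-trans yv′ vx)
  ...   | inj₂ yx  = ¬yx yx

module _ {F G : Adjacency n} where

  private
    isArc? : (A : Adjacency n) → Decidable (λ (e : Fin n × Fin n) → T (A (proj₁ e) (proj₂ e)))
    isArc? A e = T? (A (proj₁ e) (proj₂ e))

    ∈-allArcs : ∀ c d → (c , d) ∈ cartesianProduct (allFin n) (allFin n)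
    ∈-allArcs c d = ∈-cartesianProduct⁺ (∈-allFin c) (∈-allFin d)

    T⇒≡ : ∀ {b} → T b → b ≡ true
    T⇒≡ = Equivalence.to T-≡

    ≡⇒T : ∀ {b} → b ≡ true → T b
    ≡⇒T = Equivalence.from T-≡

  arcCount-< : (∀ {c d} → F c d ≡ true → G c d ≡ true) →
               ∀ {x y} → ¬ F x y ≡ true → G x y ≡ true → arcCount F < arcCount G
  arcCount-< F⊆G {x} {y} ¬Fxy Gxy =
    filter-length-< (isArc? F) (isArc? G) (All.tabulate λ _ → ≡⇒T ∘ F⊆G ∘ T⇒≡)
      (∈-allArcs x y) (¬Fxy ∘ T⇒≡) (≡⇒T Gxy)

  arcCount-exchange : ∀ {c′ d′} →
                      (∀ {c d} → (c , d) ≢ (c′ , d′) → F c d ≡ true → G c d ≡ true) →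
                      ∀ {x y} → ¬ F x y ≡ true → G x y ≡ true → arcCount F ≤ arcCount G
  arcCount-exchange F⊆G {x} {y} ¬Fxy Gxy =
    filter-length-exchange (≡-dec _≟_ _≟_) (isArc? F) (isArc? G)
      (cartesianProduct⁺ (allFin⁺ n) (allFin⁺ n)) (∈-allArcs x y) (¬Fxy ∘ T⇒≡) (≡⇒T Gxy)
      (λ cd≢c′d′ → ≡⇒T ∘ F⊆G cd≢c′d′ ∘ T⇒≡)

IsRoot : Adjacency n → Fin n → Set
IsRoot A j = ∀ k → ¬ A k j ≡ true

InDegree≤1 : Adjacency n → Set
InDegree≤1 A = ∀ k k′ j → A k j ≡ true → A k′ j ≡ true → k ≡ k′

root-unreachable : ∀ {A : Adjacency n} {u j} → IsRoot A j → ¬ Path A u j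
root-unreachable root p with path-last p
... | k , _ , kj = root k kj

-- redirect A x y makes x the only parent of y. It is opaque so that unification treats
-- redirect A x y c d as rigid rather than unfolding it into the decisions on c and d.
opaque
  redirect : Adjacency n → Fin n → Fin n → Adjacency n
  redirect A x y c d = if does (d ≟ y) then does (c ≟ x) else A c d

module Redirect (A : Adjacency n) (x y : Fin n) where

  opaque
    unfolding redirect

    redirect-new : redirect A x y x y ≡ true
    redirect-new rewrite dec-true (y ≟ y) refl | dec-true (x ≟ x) refl = refl

    redirect-into : ∀ {c} → redirect A x y c y ≡ true → c ≡ x
    redirect-into {c} cy with y ≟ y | c ≟ x
    ... | _      | yes c≡x = c≡x
    ... | yes _  | no _    = contradiction cy λ ()
    ... | no y≢y | no _    = contradiction refl y≢y

    redirect-away : ∀ {c d} → d ≢ y → redirect A x y c d ≡ A c d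
    redirect-away {d = d} d≢y rewrite dec-false (d ≟ y) d≢y = refl

  redirect-keeps : ∀ {c d} → d ≢ y → A c d ≡ true → redirect A x y c d ≡ true
  redirect-keeps d≢y cd = trans (redirect-away d≢y) cd

  redirect-⊆ : ∀ {c d} → redirect A x y c d ≡ true → (c ≡ x × d ≡ y) ⊎ A c d ≡ true
  redirect-⊆ {d = d} cd = case d ≟ y of λ where
    (yes refl) → inj₁ (redirect-into cd , refl)
    (no d≢y)   → inj₂ (trans (sym (redirect-away d≢y)) cd)

  redirect-isRoot : ∀ {j} → j ≢ y → IsRoot A j → IsRoot (redirect A x y) j
  redirect-isRoot j≢y root k kj = root k (trans (sym (redirect-away j≢y)) kj)

  redirect-reaches : ∀ {u} → u ≢ y → Reachable (redirect A x y) u y → Reachable A u x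
  redirect-reaches u≢y here     = contradiction refl u≢y
  redirect-reaches {u} u≢y (path p) with path-last p
  ... | _ , uv , vy = Sum.reduce (reachable-decompose redirect-⊆ ux)
    where
    ux : Reachable (redirect A x y) u x
    ux = subst (Reachable (redirect A x y) u) (redirect-into vy) uv

  redirect-isOutForest : (Γ : Digraph n) → IsOutForest Γ A → arc Γ x y ≡ true →
                         ¬ Reachable A y x → IsOutForest Γ (redirect A x y)
  redirect-isOutForest Γ (spanning , acyclic , indegree) xy ¬yx =
    spanning′ , acyclic-extend redirect-⊆ acyclic ¬yx , indegree′
    where
    spanning′ : SpanningSubgraph Γ (redirect A x y)
    spanning′ c d cd with redirect-⊆ cd
    ... | inj₁ (refl , refl) = xy
    ... | inj₂ cd′           = spanning c d cd′

    indegree′ : InDegree≤1 (redirect A x y)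
    indegree′ k k′ d kd k′d = case d ≟ y of λ where
      (yes refl) → trans (redirect-into kd) (sym (redirect-into k′d))
      (no d≢y)   → indegree k k′ d (trans (sym (redirect-away d≢y)) kd)
                                   (trans (sym (redirect-away d≢y)) k′d)

  arcCount-redirect-root : IsRoot A y → arcCount A < arcCount (redirect A x y)
  arcCount-redirect-root root =
    arcCount-< {F = A} {G = redirect A x y} (λ {c} cd → redirect-keeps (λ { refl → root c cd }) cd)
      (root x) redirect-new

  arcCount-redirect : InDegree≤1 A → ∀ {p} → A p y ≡ true → ¬ A x y ≡ true →
                      arcCount A ≤ arcCount (redirect A x y)
  arcCount-redirect indegree {p} py ¬xy =
    arcCount-exchange {F = A} {G = redirect A x y} kept ¬xy redirect-new
    where
    kept : ∀ {c d} → (c , d) ≢ (p , y) → A c d ≡ true → redirect A x y c d ≡ true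
    kept {c} cd≢py cd = redirect-keeps (λ { refl → cd≢py (cong (_, y) (indegree c p y cd py)) }) cd

module _ (Γ : Digraph n) where

  root-reaches-in-neighbour : ∀ {F x j} → IsMaximumOutForest Γ F → IsRoot F j →
                              arc Γ x j ≡ true → Reachable F j x
  root-reaches-in-neighbour {F} {x} {j} (forest , maximum) root xj with reachable? F j x
  ... | yes jx = jx
  ... | no ¬jx = contradiction (maximum _ (redirect-isOutForest Γ forest xj ¬jx))
                               (<⇒≱ (arcCount-redirect-root root))
    where open Redirect F x j

  redirect-isMaximumOutForest : ∀ {F x y j} → IsMaximumOutForest Γ F → arc Γ x y ≡ true →
                                Path F j y → ¬ Reachable F j x →
                                IsMaximumOutForest Γ (redirect F x y)
  redirect-isMaximumOutForest {F} {x} {y} {j} (forest@(_ , _ , indegree) , maximum) xy jy ¬jx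
    with p , jp , py ← path-last jy =
    forest′ , λ H H-forest → ≤-trans (maximum H H-forest) (arcCount-redirect indegree py ¬xy)
    where
    open Redirect F x y
    forest′ : IsOutForest Γ (redirect F x y)
    forest′ = redirect-isOutForest Γ forest xy (¬jx ∘ reachable-trans (path jy))
    ¬xy : ¬ F x y ≡ true
    ¬xy Fxy = ¬jx (subst (Reachable F j) (indegree p x y py Fxy) jp)

  root-reaches : ∀ {F x j} → Path (arc Γ) x j → IsMaximumOutForest Γ F → IsRoot F j →
                 Reachable F j x
  root-reaches (edge xj) maxF root = root-reaches-in-neighbour maxF root xj
  root-reaches {F} {x} {j} (step {j = y} xy yj) maxF root
    with reachable? F j x | root-reaches yj maxF root
  ... | yes jx | _       = jx
  ... | no _   | here    = root-reaches-in-neighbour maxF root xy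
  ... | no ¬jx | path jy = contradiction (redirect-reaches j≢y jy′) ¬jx
    where
    open Redirect F x y
    j≢y : j ≢ y
    j≢y refl = root-unreachable root jy
    jy′ : Reachable (redirect F x y) j y
    jy′ = root-reaches yj (redirect-isMaximumOutForest maxF xy jy ¬jx) (redirect-isRoot j≢y root)

lemma4 : {n : ℕ} (Γ : Digraph n) (F : Fin n → Fin n → Bool) (i j : Fin n)
    → IsMaximumOutForest Γ F
    → Path (arc Γ) i j
    → ¬ Path F i j
    → (∃ λ k → (¬ k ≡ i) × F k j ≡ true) ⊎ Reachable F j i
lemma4 Γ F i j maxF ij ¬Fij with any? (λ k → F k j Bool.≟ true)
... | yes (k , kj) = inj₁ (k , (λ { refl → ¬Fij (edge kj) }) , kj)
... | no ¬parent   = inj₂ (root-reaches Γ ij maxF λ k kj → ¬parent (k , kj))
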